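{- Let $a,b$ be positive integers such that $b\mid a$ and every prime $p$ dividing $a$ also divides $a/b$. Then the sequence $(a^n/b)_{n\ge1}$ is realizable, i.e. there are a set $X$ and a map $T\colon X\to X$ such that $T^n$ has exactly $a^n/b$ fixed points for every $n\ge1$.
   Context: A sequence $(a_n)_{n\ge1}$ of non-negative integers is realizable if there are a set $X$ and a map $T\colon X\to X$ such that $a_n$ is the number of fixed points of $T^n$ for every $n\ge1$. -}

module Defs where

open import Data.Nat using (ℕ; suc)
open import Data.Fin using (Fin)
open import Data.Product using (Σ; ∃)
open import Function using (_↔_)
open import Relation.Binary.PropositionalEquality using (_≡_)

iter : {X : Set} → (X → X) → ℕ → X → X
iter T ℕ.zero x = x
iter T (suc n) x = T (iter T n x)

Fix : {X : Set} → (X → X) → ℕ → Set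
Fix {X} T n = Σ X (λ x → iter T n x ≡ x)

Realizable : (ℕ → ℕ) → Set₁
Realizable a = Σ Set (λ X → Σ (X → X) (λ T → (n : ℕ) → Fin (a (suc n)) ↔ Fix T (suc n)))

-- Write a = c b, so that the sequence is c a^(n-1). A sequence a is realized by disjoint cycles,
-- R(n)/n of them of each length n, as soon as the numbers R(n) determined by a(n) = Σ_{d ∣ n} R(d)
-- are non-negative and divisible by n. Non-negativity holds because c a^(n-1) grows faster than
-- its partial sums once a ≥ 2. Divisibility is checked one prime power at a time and reduces to
-- Dold's congruences a(n p) ≡ a(n) (mod p^(k+1)) for p^k ∣ n: when p ∤ a they follow, after
-- multiplying by a, from those of x^n, which come from Fermat's little theorem lifted to prime
-- powers by the freshman's dream; when p ∣ a the hypothesis gives p ∣ c, so both sides are multiples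
-- of c a^(n-1), which p^n and hence p^(k+1) divide. The case a = 1 is a single fixed point.

{-# OPTIONS --safe #-}
module Submission where

open import Defs
open import Data.Nat using (ℕ; suc; _^_; _/_; NonZero; _<_)
open import Data.Nat.Divisibility using (_∣_)
open import Data.Nat.Primality using (Prime)

open import Data.Nat.Base
open import Data.Nat.Properties
open import Data.Nat.Divisibility
  using (divides; _∣?_; _∣0; 1∣_; ∣-refl; ∣-trans; ∣1⇒≡1; ∣⇒≤; >⇒∤; ∣m∣n⇒∣m+n; ∣m+n∣m⇒∣n; m∣m*n; ∣n⇒∣m*n; *-pres-∣; *-monoʳ-∣; *-monoˡ-∣; *-cancelˡ-∣)
open import Data.Nat.Primality using (euclidsLemma; prime⇒nonZero; prime⇒nonTrivial; ¬prime[0]; ¬prime[1])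
open import Data.Nat.Combinatorics using (_C_; nCn≡1; nCk≡n!/k![n-k]!; k![n∸k]!∣n!)
open import Data.Nat.DivMod using (m/n*n≡m; m*n/n≡m; n/1≡n; _mod_; m%n<n; m<n⇒m%n≡m; %-distribˡ-+; m%n%n≡m%n; [m+kn]%n≡m%n; m≡m%n+[m/n]*n)
open import Data.Nat.Induction using (<-rec)
open import Data.Nat.Primality.Factorisation using (factorise)
open import Data.Nat.ListAction using (product)
open import Data.List.Base using ([]; _∷_)
open import Data.List.Relation.Unary.All using ([]; _∷_)
open import Data.Fin.Base as Fin using (Fin; toℕ; inject₁; fromℕ)
open import Data.Fin.Properties using (toℕ-inject₁; toℕ-fromℕ; toℕ<n; toℕ-fromℕ<; toℕ-injective; +↔⊎; *↔×)
open import Data.Vec.Functional using (Vector; init)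
open import Data.Product using (Σ; ∃; _×_; _,_; proj₂)
open import Data.Product.Function.Dependent.Propositional using (Σ-↔)
open import Data.Product.Function.NonDependent.Propositional using (_×-↔_)
open import Data.Sum.Function.Propositional using (_⊎-↔_)
open import Function using (_↔_; mk↔ₛ′)
open import Function.Properties.Inverse using (↔-refl; ↔-trans)
open import Axiom.UniquenessOfIdentityProofs.WithK using (uip)
open import Data.Sum using (_⊎_; inj₁; inj₂)
open import Data.Unit using (⊤; tt)
open import Relation.Nullary using (¬_; Dec; yes; no; contradiction; ¬?)
open import Relation.Nullary.Decidable using (_×-dec_)
open import Relation.Binary.PropositionalEquality
open import Data.Nat.Tactic.RingSolver using (solve-∀)
import Algebra.Properties.CommutativeSemiring.Binomial +-*-commutativeSemiring as Binomial
import Algebra.Properties.Monoid.Sum +-0-monoid as VectorSum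
import Algebra.Definitions.RawMonoid +-0-rawMonoid as Mult
import Algebra.Properties.Semiring.Exp +-*-semiring as Exp

-- Divisibility by prime powers

prime>1 : ∀ {p} → Prime p → 1 < p
prime>1 {p} pr = nonTrivial⇒n>1 p {{prime⇒nonTrivial pr}}

^-monoˡ-∣ : ∀ {m o} n → m ∣ o → m ^ n ∣ o ^ n
^-monoˡ-∣ zero _ = ∣-refl
^-monoˡ-∣ (suc n) m∣o = *-pres-∣ m∣o (^-monoˡ-∣ n m∣o)

^-monoʳ-∣ : ∀ m {n o} → n ≤ o → m ^ n ∣ m ^ o
^-monoʳ-∣ m {n} {o} n≤o = divides (m ^ (o ∸ n)) (trans (cong (m ^_) (sym (m∸n+n≡m n≤o))) (^-distribˡ-+-* m (o ∸ n) n))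

m*n>0⇒m>0 : ∀ m {n} → 0 < m * n → 0 < m
m*n>0⇒m>0 (suc m) _ = z<s

m∣m^n : ∀ m {n} → 0 < n → m ∣ m ^ n
m∣m^n m {suc n} _ = m∣m*n (m ^ n)

prime-power-divisor : ∀ {p c} → Prime p → ¬ p ∣ c → ∀ k {d} → p ^ k ∣ c * d → p ^ k ∣ d
prime-power-divisor _ _ zero {d} _ = 1∣ d
prime-power-divisor {p} {c} pr p∤c (suc k) {d} p^k+1∣cd with euclidsLemma c d pr (∣-trans (m∣m*n (p ^ k)) p^k+1∣cd)
... | inj₁ p∣c = contradiction p∣c p∤c
... | inj₂ (divides d′ refl) = subst (p * p ^ k ∣_) (*-comm p d′) (*-monoʳ-∣ p p^k∣d′)
  where
  instance _ = prime⇒nonZero pr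
  reorder : ∀ x y z → x * (y * z) ≡ z * (x * y)
  reorder = solve-∀
  p^k∣d′ : p ^ k ∣ d′
  p^k∣d′ = prime-power-divisor pr p∤c k (*-cancelˡ-∣ p (subst (p * p ^ k ∣_) (reorder c d′ p) p^k+1∣cd))

0<m≤pred[n]⇒m<n : ∀ {m n} → 0 < m → m ≤ pred n → m < n
0<m≤pred[n]⇒m<n {n = zero} () z≤n
0<m≤pred[n]⇒m<n {n = suc _} _ m≤n = s≤s m≤n

n<m^n : ∀ {m} → 1 < m → ∀ n → n < m ^ n
n<m^n _ zero = z<s
n<m^n {m} 1<m (suc n) = begin-strict
  suc n        ≤⟨ n<m^n 1<m n ⟩
  m ^ n        <⟨ m<m*n (m ^ n) m 1<m ⟩
  m ^ n * m    ≡⟨ *-comm (m ^ n) m ⟩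
  m ^ suc n    ∎
  where
  open ≤-Reasoning
  instance _ = m^n≢0 m n {{>-nonZero (<-trans z<s 1<m)}}

∣-irrelevant : ∀ {m n} → .{{NonZero m}} → (x y : m ∣ n) → x ≡ y
∣-irrelevant {m} (divides q e) (divides q′ e′) with *-cancelʳ-≡ q q′ m (trans (sym e) e′)
... | refl = cong (divides q) (uip e e′)

new-divisor-prime-power : ∀ {p n′ d} → Prime p → ∀ k → p ^ k ∣ n′ * p → d ∣ n′ * p → ¬ d ∣ n′ → p ^ k ∣ d
new-divisor-prime-power {p} {n′} {d} pr k p^k∣n′p (divides q n′p≡qd) d∤n′ =
  prime-power-divisor pr p∤q k (subst (p ^ k ∣_) n′p≡qd p^k∣n′p)
  where
  instance _ = prime⇒nonZero pr
  p∤q : ¬ p ∣ q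
  p∤q (divides q′ refl) = d∤n′ (divides q′ (*-cancelʳ-≡ n′ (q′ * d) p (trans n′p≡qd (reorder q′ p d))))
    where
    reorder : ∀ x y z → x * y * z ≡ x * z * y
    reorder = solve-∀

∃prime∣ : ∀ n → 1 < n → ∃ λ p → Prime p × p ∣ n
∃prime∣ 1 (s≤s ())
∃prime∣ n@(suc (suc _)) _ with factorise n
... | record { factors = [] ; isFactorisation = () }
... | record { factors = p ∷ ps ; isFactorisation = n≡p*ps ; factorsPrime = p-prime ∷ _ } =
  p , p-prime , subst (p ∣_) (sym n≡p*ps) (m∣m*n (product ps))

prime-power-decomposition : ∀ {p} → Prime p → ∀ n → 0 < n → ∃ λ k → ∃ λ m → n ≡ p ^ k * m × ¬ p ∣ m
prime-power-decomposition {p} pr = <-rec P decompose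
  where
  instance _ = prime⇒nonZero pr
  P : ℕ → Set
  P n = 0 < n → ∃ λ k → ∃ λ m → n ≡ p ^ k * m × ¬ p ∣ m
  decompose : ∀ n → (∀ {n′} → n′ < n → P n′) → P n
  decompose n ih 0<n with p ∣? n
  ... | no p∤n = 0 , n , sym (+-identityʳ n) , p∤n
  ... | yes (divides n′ refl) with ih (m<m*n n′ p {{>-nonZero 0<n′}} (prime>1 pr)) 0<n′
    where
    0<n′ = m*n>0⇒m>0 n′ 0<n
  ... | k , m , refl , p∤m = suc k , m , reorder (p ^ k) m p , p∤m
    where
    reorder : ∀ x y z → x * y * z ≡ z * x * y
    reorder = solve-∀

∣-by-prime-powers : ∀ n → 0 < n → ∀ M → (∀ {p} → Prime p → ∀ k → p ^ k ∣ n → p ^ k ∣ M) → n ∣ M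
∣-by-prime-powers = <-rec P by-prime-powers
  where
  P : ℕ → Set
  P n = 0 < n → ∀ M → (∀ {p} → Prime p → ∀ k → p ^ k ∣ n → p ^ k ∣ M) → n ∣ M
  by-prime-powers : ∀ n → (∀ {n′} → n′ < n → P n′) → P n
  by-prime-powers 1 _ _ M _ = 1∣ M
  by-prime-powers n@(suc (suc _)) ih 0<n M n-powers∣M with ∃prime∣ n (s≤s z<s)
  ... | p , pr , p∣n with prime-power-decomposition pr n 0<n
  ... | zero , m , n≡m , p∤m = contradiction (subst (p ∣_) (trans n≡m (+-identityʳ m)) p∣n) p∤m
  ... | suc k , m , n≡p^[1+k]*m , p∤m = subst (_∣ M) (sym n≡p^[1+k]*m) p^[1+k]*m∣M
    where
    instance _ = prime⇒nonZero pr
    n≡m*p^[1+k] : n ≡ m * p ^ suc k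
    n≡m*p^[1+k] = trans n≡p^[1+k]*m (*-comm (p ^ suc k) m)
    0<m : 0 < m
    0<m = m*n>0⇒m>0 m (subst (0 <_) n≡m*p^[1+k] 0<n)
    m<n : m < n
    m<n = subst (m <_) (sym n≡m*p^[1+k]) (m<m*n m (p ^ suc k) {{>-nonZero 0<m}} (*-mono-≤ (prime>1 pr) (m^n>0 p k)))
    p^[1+k]*m∣M : p ^ suc k * m ∣ M
    p^[1+k]*m∣M with ih m<n 0<m M (λ pr′ k′ d∣m → n-powers∣M pr′ k′ (∣-trans d∣m (divides (p ^ suc k) n≡p^[1+k]*m)))
    ... | divides t refl = *-monoˡ-∣ m (prime-power-divisor pr p∤m (suc k)
      (subst (p ^ suc k ∣_) (*-comm t m) (n-powers∣M pr (suc k) (divides m n≡m*p^[1+k]))))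

-- Finite sums and congruences

∑< : ℕ → (ℕ → ℕ) → ℕ
∑< zero f = 0
∑< (suc n) f = ∑< n f + f n

infix 10 ∑<
syntax ∑< n (λ i → x) = ∑[ i < n ] x

module _ {f g : ℕ → ℕ} where

  ∑<-cong : ∀ n → (∀ i → i < n → f i ≡ g i) → ∑[ i < n ] f i ≡ ∑[ i < n ] g i
  ∑<-cong zero _ = refl
  ∑<-cong (suc n) f≡g = cong₂ _+_ (∑<-cong n (λ i i<n → f≡g i (m<n⇒m<1+n i<n))) (f≡g n (n<1+n n))

  ∑<-mono-≤ : ∀ n → (∀ i → i < n → f i ≤ g i) → ∑[ i < n ] f i ≤ ∑[ i < n ] g i
  ∑<-mono-≤ zero _ = z≤n
  ∑<-mono-≤ (suc n) f≤g = +-mono-≤ (∑<-mono-≤ n (λ i i<n → f≤g i (m<n⇒m<1+n i<n))) (f≤g n (n<1+n n))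

  ∑<-distrib-+ : ∀ n → ∑[ i < n ] (f i + g i) ≡ ∑[ i < n ] f i + ∑[ i < n ] g i
  ∑<-distrib-+ zero = refl
  ∑<-distrib-+ (suc n) = trans (cong (_+ (f n + g n)) (∑<-distrib-+ n)) (interchange (∑< n f) (∑< n g) (f n) (g n))
    where
    interchange : ∀ a b c d → (a + b) + (c + d) ≡ (a + c) + (b + d)
    interchange = solve-∀

∑<-∣ : ∀ {d} {f : ℕ → ℕ} n → (∀ i → i < n → d ∣ f i) → d ∣ ∑[ i < n ] f i
∑<-∣ zero _ = _ ∣0
∑<-∣ {f = f} (suc n) d∣f = ∣m∣n⇒∣m+n (∑<-∣ {f = f} n (λ i i<n → d∣f i (m<n⇒m<1+n i<n))) (d∣f n (n<1+n n))

*-distribˡ-∑< : ∀ c (f : ℕ → ℕ) n → c * ∑[ i < n ] f i ≡ ∑[ i < n ] (c * f i)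
*-distribˡ-∑< c f zero = *-zeroʳ c
*-distribˡ-∑< c f (suc n) = trans (*-distribˡ-+ c (∑< n f) (f n)) (cong (_+ c * f n) (*-distribˡ-∑< c f n))

∑<-shift : ∀ (f : ℕ → ℕ) n → ∑[ i < suc n ] f i ≡ f 0 + ∑[ i < n ] f (suc i)
∑<-shift f zero = +-comm 0 (f 0)
∑<-shift f (suc n) = trans (cong (_+ f (suc n)) (∑<-shift f n)) (+-assoc (f 0) _ (f (suc n)))

∑<-vanishing-tail : ∀ (f : ℕ → ℕ) {m} N → m ≤ N → (∀ i → m ≤ i → i < N → f i ≡ 0) → ∑[ i < N ] f i ≡ ∑[ i < m ] f i
∑<-vanishing-tail f zero z≤n _ = refl
∑<-vanishing-tail f {m} (suc N) m≤1+N f≡0 with m≤n⇒m<n∨m≡n m≤1+N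
... | inj₁ (s≤s m≤N) =
  trans (cong₂ _+_ (∑<-vanishing-tail f N m≤N (λ i m≤i i<N → f≡0 i m≤i (m<n⇒m<1+n i<N))) (f≡0 N m≤N (n<1+n N)))
        (+-identityʳ _)
... | inj₂ refl = refl

∑<-^<^ : ∀ {a} → 1 < a → ∀ m → ∑[ i < m ] (a ^ i) < a ^ m
∑<-^<^ _ zero = z<s
∑<-^<^ {a} 1<a (suc m) = begin-strict
  ∑[ i < m ] (a ^ i) + a ^ m  <⟨ +-monoˡ-< (a ^ m) (∑<-^<^ 1<a m) ⟩
  a ^ m + a ^ m               ≡⟨ cong (a ^ m +_) (+-identityʳ (a ^ m)) ⟨
  2 * a ^ m                   ≤⟨ *-monoˡ-≤ (a ^ m) 1<a ⟩
  a * a ^ m                   ∎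
  where open ≤-Reasoning

infix 4 _≡_[mod⁺_]

-- n ≡ m (mod d) together with m ≤ n, phrased without truncated subtraction
_≡_[mod⁺_] : ℕ → ℕ → ℕ → Set
n ≡ m [mod⁺ d ] = ∃ λ X → n ≡ m + X × d ∣ X

module _ {d m n : ℕ} where

  mod⁺-weaken : ∀ {d′} → d′ ∣ d → n ≡ m [mod⁺ d ] → n ≡ m [mod⁺ d′ ]
  mod⁺-weaken d′∣d (X , n≡m+X , d∣X) = X , n≡m+X , ∣-trans d′∣d d∣X

  mod⁺-+ˡ : ∀ k → n ≡ m [mod⁺ d ] → k + n ≡ k + m [mod⁺ d ]
  mod⁺-+ˡ k (X , refl , d∣X) = X , sym (+-assoc k m X) , d∣X

  mod⁺-*ˡ : ∀ c → n ≡ m [mod⁺ d ] → c * n ≡ c * m [mod⁺ d ]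
  mod⁺-*ˡ c (X , refl , d∣X) = c * X , *-distribˡ-+ c m X , ∣n⇒∣m*n c d∣X

mod⁺-trans : ∀ {d l m n} → l ≡ m [mod⁺ d ] → m ≡ n [mod⁺ d ] → l ≡ n [mod⁺ d ]
mod⁺-trans {n = n} (X , refl , d∣X) (Y , refl , d∣Y) = Y + X , +-assoc n Y X , ∣m∣n⇒∣m+n d∣Y d∣X

m*n≡m[mod⁺m] : ∀ m {n} → 0 < n → m * n ≡ m [mod⁺ m ]
m*n≡m[mod⁺m] m {suc n} _ = m * n , *-suc m n , m∣m*n n

mod⁺-cancelˡ : ∀ {p c m n} → Prime p → ¬ p ∣ c → ∀ k → c * n ≡ c * m [mod⁺ p ^ k ] → n ≡ m [mod⁺ p ^ k ]
mod⁺-cancelˡ {p} {c} {m} {n} pr p∤c k (X , cn≡cm+X , p^k∣X) = n ∸ m , sym (m+[n∸m]≡n m≤n) , p^k∣n∸m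
  where
  instance
    c≢0 : NonZero c
    c≢0 = ≢-nonZero (λ { refl → p∤c (p ∣0) })
  m≤n : m ≤ n
  m≤n = *-cancelˡ-≤ c (subst (c * m ≤_) (sym cn≡cm+X) (m≤m+n (c * m) X))
  X≡c*[n∸m] : X ≡ c * (n ∸ m)
  X≡c*[n∸m] = +-cancelˡ-≡ (c * m) X (c * (n ∸ m))
    (trans (sym cn≡cm+X) (trans (cong (c *_) (sym (m+[n∸m]≡n m≤n))) (*-distribˡ-+ c m (n ∸ m))))
  p^k∣n∸m : p ^ k ∣ n ∸ m
  p^k∣n∸m = prime-power-divisor pr p∤c k (subst (p ^ k ∣_) X≡c*[n∸m] p^k∣X)

-- Dold's congruences for x^n

Mult-×≡* : ∀ n x → n Mult.× x ≡ n * x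
Mult-×≡* zero x = refl
Mult-×≡* (suc n) x = cong (x +_) (Mult-×≡* n x)

Exp-^≡^ : ∀ x n → x Exp.^ n ≡ x ^ n
Exp-^≡^ x zero = refl
Exp-^≡^ x (suc n) = cong (x *_) (Exp-^≡^ x n)

sum-∣ : ∀ {d n} (f : Vector ℕ n) → (∀ i → d ∣ f i) → d ∣ VectorSum.sum f
sum-∣ {n = zero} f _ = _ ∣0
sum-∣ {n = suc n} f d∣f = ∣m∣n⇒∣m+n (d∣f Fin.zero) (sum-∣ (λ i → f (Fin.suc i)) (λ i → d∣f (Fin.suc i)))

prime∤! : ∀ {p m} → Prime p → m < p → ¬ p ∣ m !
prime∤! {m = zero} pr _ p∣1 = ¬prime[1] (subst Prime (∣1⇒≡1 p∣1) pr)
prime∤! {m = suc m} pr m<p p∣m! with euclidsLemma (suc m) (m !) pr p∣m!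
... | inj₁ p∣suc[m] = >⇒∤ m<p p∣suc[m]
... | inj₂ p∣m! = prime∤! pr (<-trans (n<1+n m) m<p) p∣m!

prime∣pCk : ∀ {p k} → Prime p → 0 < k → k < p → p ∣ p C k
prime∣pCk {p@(suc q)} {k} pr 0<k k<p with euclidsLemma (p C k) (k ! * (p ∸ k) !) pr p∣pCk*k![p∸k]!
  where
  instance _ = k !* (p ∸ k) !≢0
  p∣pCk*k![p∸k]! : p ∣ (p C k) * (k ! * (p ∸ k) !)
  p∣pCk*k![p∸k]! = subst (p ∣_)
    (sym (trans (cong (_* (k ! * (p ∸ k) !)) (nCk≡n!/k![n-k]! (<⇒≤ k<p))) (m/n*n≡m (k![n∸k]!∣n! (<⇒≤ k<p)))))
    (m∣m*n (q !))
... | inj₁ p∣pCk = p∣pCk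
... | inj₂ p∣k!*[p∸k]! with euclidsLemma (k !) ((p ∸ k) !) pr p∣k!*[p∸k]!
...   | inj₁ p∣k! = contradiction p∣k! (prime∤! pr k<p)
...   | inj₂ p∣[p∸k]! = contradiction p∣[p∸k]! (prime∤! pr (∸-monoʳ-< 0<k (<⇒≤ k<p)))

freshman's-dream : ∀ {p} → Prime p → ∀ v w → (v + w) ^ p ≡ v ^ p + w ^ p [mod⁺ p * w ]
freshman's-dream {p@(suc q)} pr v w = VectorSum.sum middle , expansion , sum-∣ middle p*w∣middle
  where
  open ≡-Reasoning
  t : Vector ℕ (suc p)
  t = Binomial.binomialTerm v w p
  t≡ : ∀ i → t i ≡ (p C toℕ i) * (v ^ toℕ i * w ^ (p ∸ toℕ i))
  t≡ i = trans (Mult-×≡* (p C toℕ i) _) (cong ((p C toℕ i) *_) (cong₂ _*_ (Exp-^≡^ v (toℕ i)) (Exp-^≡^ w (p ∸ toℕ i))))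
  middle : Vector ℕ q
  middle = init (λ i → t (Fin.suc i))
  p*w∣middle : ∀ i → p * w ∣ middle i
  p*w∣middle i = subst (p * w ∣_) (sym (t≡ (Fin.suc (inject₁ i))))
    (*-pres-∣ (prime∣pCk pr (s≤s z≤n) k<p) (∣n⇒∣m*n (v ^ k) (m∣m^n w (m<n⇒0<n∸m k<p))))
    where
    k = suc (toℕ (inject₁ i))
    k<p : k < p
    k<p = s≤s (subst (_< q) (sym (toℕ-inject₁ i)) (toℕ<n i))
  first-term : t Fin.zero ≡ w ^ p
  first-term = trans (t≡ Fin.zero) (trans (*-identityˡ _) (*-identityˡ _))
  last-term : t (Fin.suc (fromℕ q)) ≡ v ^ p
  last-term = begin
    t (Fin.suc (fromℕ q))                  ≡⟨ t≡ (Fin.suc (fromℕ q)) ⟩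
    (p C suc (toℕ (fromℕ q))) * _          ≡⟨ cong (λ k → (p C k) * (v ^ k * w ^ (p ∸ k))) (cong suc (toℕ-fromℕ q)) ⟩
    (p C p) * (v ^ p * w ^ (p ∸ p))        ≡⟨ cong₂ (λ c e → c * (v ^ p * w ^ e)) (nCn≡1 p) (n∸n≡0 p) ⟩
    1 * (v ^ p * 1)                        ≡⟨ trans (*-identityˡ _) (*-identityʳ _) ⟩
    v ^ p                                  ∎
  rearrange : ∀ x y z → x + (y + z) ≡ z + x + y
  rearrange = solve-∀
  expansion : (v + w) ^ p ≡ v ^ p + w ^ p + VectorSum.sum middle
  expansion = begin
    (v + w) ^ p                                              ≡⟨ Exp-^≡^ (v + w) p ⟨
    (v + w) Exp.^ p                                          ≡⟨ Binomial.theorem p v w ⟩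
    t Fin.zero + VectorSum.sum (λ i → t (Fin.suc i))         ≡⟨ cong (t Fin.zero +_) (VectorSum.sum-init-last (λ i → t (Fin.suc i))) ⟩
    t Fin.zero + (VectorSum.sum middle + t (Fin.suc (fromℕ q))) ≡⟨ cong₂ (λ a b → a + (VectorSum.sum middle + b)) first-term last-term ⟩
    w ^ p + (VectorSum.sum middle + v ^ p)                   ≡⟨ rearrange (w ^ p) (VectorSum.sum middle) (v ^ p) ⟩
    v ^ p + w ^ p + VectorSum.sum middle                     ∎

fermat : ∀ {p} → Prime p → ∀ x → x ^ p ≡ x [mod⁺ p ]
fermat {zero} pr _ = contradiction pr ¬prime[0]
fermat {suc _} pr zero = 0 , refl , _ ∣0
fermat {p} pr (suc x) = mod⁺-trans (mod⁺-weaken (m∣m*n x) (freshman's-dream pr 1 x))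
  (subst (λ y → y + x ^ p ≡ suc x [mod⁺ p ]) (sym (^-zeroˡ p)) (mod⁺-+ˡ 1 (fermat pr x)))

lift-mod⁺-prime-power : ∀ {p u v} → Prime p → ∀ j → u ≡ v [mod⁺ p ^ suc j ] → u ^ p ≡ v ^ p [mod⁺ p ^ suc (suc j) ]
lift-mod⁺-prime-power {p} {v = v} pr j (X , refl , p^[1+j]∣X) with freshman's-dream pr v X
... | M , [v+X]^p≡v^p+X^p+M , p*X∣M =
  X ^ p + M , trans [v+X]^p≡v^p+X^p+M (+-assoc (v ^ p) (X ^ p) M) , ∣m∣n⇒∣m+n p^[2+j]∣X^p (∣-trans (*-monoʳ-∣ p p^[1+j]∣X) p*X∣M)
  where
  2+j≤[1+j]*p : suc (suc j) ≤ suc j * p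
  2+j≤[1+j]*p = ≤-trans (s≤s (s≤s (m≤m*n j 2))) (*-monoʳ-≤ (suc j) (prime>1 pr))
  p^[2+j]∣X^p : p ^ suc (suc j) ∣ X ^ p
  p^[2+j]∣X^p = ∣-trans (^-monoʳ-∣ p 2+j≤[1+j]*p) (subst (_∣ X ^ p) (^-*-assoc p (suc j) p) (^-monoˡ-∣ p p^[1+j]∣X))

DoldCongruent : (ℕ → ℕ) → Set
DoldCongruent a = ∀ {p n} → Prime p → 0 < n → ∀ k → p ^ k ∣ n → a (n * p) ≡ a n [mod⁺ p ^ suc k ]

^-doldCongruent : ∀ x → DoldCongruent (x ^_)
^-doldCongruent x {p} {n} pr _ zero _ =
  subst₂ (λ y d → y ≡ x ^ n [mod⁺ d ]) (^-*-assoc x n p) (sym (*-identityʳ p)) (fermat pr (x ^ n))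
^-doldCongruent x {p} pr 0<n (suc k) p^[1+k]∣n with ∣-trans (m∣m*n {p} (p ^ k)) p^[1+k]∣n
... | divides n′ refl = subst₂ (λ y z → y ≡ z [mod⁺ p ^ suc (suc k) ]) (^-*-assoc x (n′ * p) p) (^-*-assoc x n′ p)
  (lift-mod⁺-prime-power pr k (^-doldCongruent x pr 0<n′ k p^k∣n′))
  where
  instance _ = prime⇒nonZero pr
  0<n′ : 0 < n′
  0<n′ = m*n>0⇒m>0 n′ 0<n
  p^k∣n′ : p ^ k ∣ n′
  p^k∣n′ = *-cancelˡ-∣ p (subst (p * p ^ k ∣_) (*-comm n′ p) p^[1+k]∣n)

-- Points of least period

select : ∀ {P : Set} → Dec P → ℕ → ℕ
select (yes _) x = x
select (no _) _ = 0

select-≤ : ∀ {P : Set} (P? : Dec P) (x : ℕ) → select P? x ≤ x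
select-≤ (yes _) x = ≤-refl
select-≤ (no _) x = z≤n

select-split : ∀ {P Q : Set} → (P → Q) → (P? : Dec P) (Q? : Dec Q) (x : ℕ) → select Q? x ≡ select P? x + select (¬? P? ×-dec Q?) x
select-split _ (yes _) (yes _) x = sym (+-identityʳ x)
select-split P⇒Q (yes p) (no ¬q) x = contradiction (P⇒Q p) ¬q
select-split _ (no _) (yes _) x = refl
select-split _ (no _) (no _) x = refl

divisorSum≤ : ℕ → ℕ → (ℕ → ℕ) → ℕ
divisorSum≤ N n f = ∑[ i < N ] select (suc i ∣? n) (f (suc i))

infix 10 divisorSum≤
syntax divisorSum≤ N n (λ d → x) = ∑[ d ≤ N ∣ n ] x

module _ {f : ℕ → ℕ} where

  divisorSum≤-cong : ∀ {g : ℕ → ℕ} N n → (∀ d → 0 < d → d ≤ N → f d ≡ g d) → ∑[ d ≤ N ∣ n ] f d ≡ ∑[ d ≤ N ∣ n ] g d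
  divisorSum≤-cong N n f≡g = ∑<-cong N (λ i i<N → cong (select (suc i ∣? n)) (f≡g (suc i) z<s i<N))

  divisorSum≤-≤-∑ : ∀ N n → ∑[ d ≤ N ∣ n ] f d ≤ ∑[ i < N ] f (suc i)
  divisorSum≤-≤-∑ N n = ∑<-mono-≤ N (λ i _ → select-≤ (suc i ∣? n) (f (suc i)))

  divisorSum≤-trim : ∀ {n} N → 0 < n → n ≤ N → ∑[ d ≤ N ∣ n ] f d ≡ ∑[ d ≤ n ∣ n ] f d
  divisorSum≤-trim {n} N 0<n n≤N = ∑<-vanishing-tail _ N n≤N beyond-n
    where
    beyond-n : ∀ i → n ≤ i → i < N → select (suc i ∣? n) (f (suc i)) ≡ 0
    beyond-n i n≤i _ with suc i ∣? n
    ... | yes 1+i∣n = contradiction 1+i∣n (>⇒∤ {{>-nonZero 0<n}} (s≤s n≤i))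
    ... | no _ = refl

  divisorSum≤-split : ∀ {n′ n} N → n′ ∣ n →
    ∑[ d ≤ N ∣ n ] f d ≡ ∑[ d ≤ N ∣ n′ ] f d + ∑[ i < N ] select (¬? (suc i ∣? n′) ×-dec suc i ∣? n) (f (suc i))
  divisorSum≤-split {n′} {n} N n′∣n =
    trans (∑<-cong N (λ i _ → select-split (λ d∣n′ → ∣-trans d∣n′ n′∣n) (suc i ∣? n′) (suc i ∣? n) (f (suc i))))
          (∑<-distrib-+ N)

private
  leastPeriodCountWithin : (ℕ → ℕ) → ℕ → ℕ → ℕ
  leastPeriodCountWithin a zero _ = 0
  leastPeriodCountWithin a (suc fuel) n = a n ∸ ∑[ d ≤ pred n ∣ n ] leastPeriodCountWithin a fuel d

-- R with a n = Σ_{d ∣ n} R d, i.e. the Möbius inversion of a (truncated at 0): in a realization of a,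
-- the number of points of least period n. Fuel suc n suffices as the recursion only visits proper divisors.
leastPeriodCount : (ℕ → ℕ) → ℕ → ℕ
leastPeriodCount a n = leastPeriodCountWithin a (suc n) n

Superincreasing : (ℕ → ℕ) → Set
Superincreasing a = ∀ n → ∑[ i < n ] a (suc i) ≤ a (suc n)

module _ (a : ℕ → ℕ) where

  private
    R = leastPeriodCount a

    within-stable : ∀ f g n → n < f → n < g → leastPeriodCountWithin a f n ≡ leastPeriodCountWithin a g n
    within-stable (suc f) (suc g) n (s≤s n≤f) (s≤s n≤g) = cong (a n ∸_) (divisorSum≤-cong (pred n) n
      (λ d 0<d d≤pred[n] → let d<n = 0<m≤pred[n]⇒m<n 0<d d≤pred[n] in
        within-stable f g d (<-≤-trans d<n n≤f) (<-≤-trans d<n n≤g)))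

  leastPeriodCount-unfold : ∀ n → R n ≡ a n ∸ ∑[ d ≤ pred n ∣ n ] R d
  leastPeriodCount-unfold n = cong (a n ∸_) (divisorSum≤-cong (pred n) n
    (λ d 0<d d≤pred[n] → within-stable n (suc d) d (0<m≤pred[n]⇒m<n 0<d d≤pred[n]) (n<1+n d)))

  leastPeriodCount≤ : ∀ n → R n ≤ a n
  leastPeriodCount≤ n = subst (_≤ a n) (sym (leastPeriodCount-unfold n)) (m∸n≤m (a n) (∑[ d ≤ pred n ∣ n ] R d))

  module _ (superincreasing : Superincreasing a) where

    divisorSum-leastPeriodCount : ∀ {n} → 0 < n → ∑[ d ≤ n ∣ n ] R d ≡ a n
    divisorSum-leastPeriodCount {suc n} _ with suc n ∣? suc n
    ... | no n∤n = contradiction ∣-refl n∤n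
    ... | yes _ = trans (cong (S +_) (leastPeriodCount-unfold (suc n))) (m+[n∸m]≡n S≤a)
      where
      open ≤-Reasoning
      S = ∑[ d ≤ n ∣ suc n ] R d
      S≤a : S ≤ a (suc n)
      S≤a = begin
        S                       ≤⟨ divisorSum≤-≤-∑ {f = R} n (suc n) ⟩
        ∑[ i < n ] R (suc i)    ≤⟨ ∑<-mono-≤ n (λ i _ → leastPeriodCount≤ (suc i)) ⟩
        ∑[ i < n ] a (suc i)    ≤⟨ superincreasing n ⟩
        a (suc n)               ∎

    divisorSum-leastPeriodCount-difference : ∀ {n′ m} → n′ ∣ suc m → 0 < n′ → n′ < suc m →
      a (suc m) ≡ a n′ + (∑[ i < m ] select (¬? (suc i ∣? n′) ×-dec suc i ∣? suc m) (R (suc i)) + R (suc m))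
    divisorSum-leastPeriodCount-difference {n′} {m} n′∣n 0<n′ n′<n = begin
      a (suc m)                                                   ≡⟨ divisorSum-leastPeriodCount z<s ⟨
      ∑[ d ≤ suc m ∣ suc m ] R d                                  ≡⟨ divisorSum≤-split {f = R} (suc m) n′∣n ⟩
      ∑[ d ≤ suc m ∣ n′ ] R d + (∑[ i < m ] new i + new m)        ≡⟨ cong₂ _+_ old≡a[n′] (cong (∑[ i < m ] new i +_) new[m]≡R) ⟩
      a n′ + (∑[ i < m ] new i + R (suc m))                        ∎
      where
      open ≡-Reasoning
      new : ℕ → ℕ
      new i = select (¬? (suc i ∣? n′) ×-dec suc i ∣? suc m) (R (suc i))
      old≡a[n′] : ∑[ d ≤ suc m ∣ n′ ] R d ≡ a n′
      old≡a[n′] = trans (divisorSum≤-trim {f = R} (suc m) 0<n′ (<⇒≤ n′<n)) (divisorSum-leastPeriodCount 0<n′)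
      new[m]≡R : new m ≡ R (suc m)
      new[m]≡R with suc m ∣? n′ | suc m ∣? suc m
      ... | yes n∣n′ | _ = contradiction n∣n′ (>⇒∤ {{>-nonZero 0<n′}} n′<n)
      ... | no _ | yes _ = refl
      ... | no _ | no n∤n = contradiction ∣-refl n∤n

    module _ (dold : DoldCongruent a) where

      private
        -- a (n′ p) − a n′ is the sum of R d over the divisors d of n′ p not dividing n′; these d are
        -- multiples of p^(k+1), hence by induction so is R d for d < n′ p, and therefore also R (n′ p)
        p^[1+k]∣leastPeriodCount : ∀ {p n′ m} → Prime p → suc m ≡ n′ * p → 0 < n′ → ∀ k → p ^ k ∣ n′ →
          (∀ {d} → d < suc m → 0 < d → d ∣ R d) → p ^ suc k ∣ R (suc m)
        p^[1+k]∣leastPeriodCount {p} {n′} {m} pr n≡n′p 0<n′ k p^k∣n′ ih with dold pr 0<n′ k p^k∣n′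
        ... | X , a[n′p]≡a[n′]+X , p^[1+k]∣X = ∣m+n∣m⇒∣n (subst (p ^ suc k ∣_) X≡new+R p^[1+k]∣X) (∑<-∣ m p^[1+k]∣new)
          where
          n′<n : n′ < suc m
          n′<n = subst (n′ <_) (sym n≡n′p) (m<m*n n′ p {{>-nonZero 0<n′}} (prime>1 pr))
          p^[1+k]∣n : p ^ suc k ∣ n′ * p
          p^[1+k]∣n = subst (p ^ suc k ∣_) (*-comm p n′) (*-monoʳ-∣ p p^k∣n′)
          new : ℕ → ℕ
          new i = select (¬? (suc i ∣? n′) ×-dec suc i ∣? suc m) (R (suc i))
          X≡new+R : X ≡ ∑[ i < m ] new i + R (suc m)
          X≡new+R = +-cancelˡ-≡ (a n′) X _ (trans (sym a[n′p]≡a[n′]+X) (trans (cong a (sym n≡n′p))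
            (divisorSum-leastPeriodCount-difference (divides p (trans n≡n′p (*-comm n′ p))) 0<n′ n′<n)))
          p^[1+k]∣new : ∀ i → i < m → p ^ suc k ∣ new i
          p^[1+k]∣new i i<m with suc i ∣? n′ | suc i ∣? suc m
          ... | yes _ | _ = _ ∣0
          ... | no _ | no _ = _ ∣0
          ... | no d∤n′ | yes d∣n = ∣-trans
            (new-divisor-prime-power pr (suc k) p^[1+k]∣n (subst (suc i ∣_) n≡n′p d∣n) d∤n′)
            (ih (s≤s i<m) z<s)

      prime-power∣leastPeriodCount : ∀ {p n} → Prime p → 0 < n → ∀ k → p ^ k ∣ n →
        (∀ {d} → d < n → 0 < d → d ∣ R d) → p ^ k ∣ R n
      prime-power∣leastPeriodCount {n = n} _ _ zero _ _ = 1∣ R n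
      prime-power∣leastPeriodCount {p} {suc m} pr _ (suc k) p^[1+k]∣n ih with ∣-trans (m∣m*n {p} (p ^ k)) p^[1+k]∣n
      ... | divides n′ n≡n′p = p^[1+k]∣leastPeriodCount pr n≡n′p 0<n′ k p^k∣n′ ih
        where
        instance _ = prime⇒nonZero pr
        0<n′ : 0 < n′
        0<n′ = m*n>0⇒m>0 n′ (subst (0 <_) n≡n′p z<s)
        p^k∣n′ : p ^ k ∣ n′
        p^k∣n′ = *-cancelˡ-∣ p (subst (p * p ^ k ∣_) (trans n≡n′p (*-comm n′ p)) p^[1+k]∣n)

      leastPeriodCount-divisible : ∀ n → 0 < n → n ∣ R n
      leastPeriodCount-divisible = <-rec _ λ n ih 0<n →
        ∣-by-prime-powers n 0<n (R n) (λ pr k p^k∣n → prime-power∣leastPeriodCount pr 0<n k p^k∣n ih)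

-- Realization by disjoint cycles

Realizable-cong : ∀ (a b : ℕ → ℕ) → (∀ n → a (suc n) ≡ b (suc n)) → Realizable a → Realizable b
Realizable-cong _ _ a≗b (X , T , Fin↔Fix) = X , T , λ n → subst (λ m → Fin m ↔ Fix T (suc n)) (a≗b n) (Fin↔Fix n)

Below : ℕ → (ℕ → Set) → Set
Below N A = Σ ℕ λ k → k < N × A k

Below-cong : ∀ {N} {A B : ℕ → Set} → (∀ k → A k ↔ B k) → Below N A ↔ Below N B
Below-cong A↔B = Σ-↔ ↔-refl (λ {k} → ↔-refl ×-↔ A↔B k)

Below-suc↔ : ∀ {N} (A : ℕ → Set) → (A 0 ⊎ Below N (λ k → A (suc k))) ↔ Below (suc N) A
Below-suc↔ {N} A = mk↔ₛ′ to from to∘from from∘to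
  where
  to : A 0 ⊎ Below N (λ k → A (suc k)) → Below (suc N) A
  to (inj₁ x) = 0 , z<s , x
  to (inj₂ (k , k<N , x)) = suc k , s<s k<N , x
  from : Below (suc N) A → A 0 ⊎ Below N (λ k → A (suc k))
  from (zero , _ , x) = inj₁ x
  from (suc k , s<s k<N , x) = inj₂ (k , k<N , x)
  to∘from : ∀ y → to (from y) ≡ y
  to∘from (zero , z<s , x) = refl
  to∘from (suc k , s<s k<N , x) = refl
  from∘to : ∀ x → from (to x) ≡ x
  from∘to (inj₁ x) = refl
  from∘to (inj₂ x) = refl

Fin-∑<↔ : ∀ (h : ℕ → ℕ) N → Fin (∑[ k < N ] h k) ↔ Below N (λ k → Fin (h k))
Fin-∑<↔ h zero = mk↔ₛ′ (λ ()) (λ { (_ , () , _) }) (λ { (_ , () , _) }) (λ ())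
Fin-∑<↔ h (suc N) = ↔-trans (subst (λ m → Fin (∑[ k < suc N ] h k) ↔ Fin m) (∑<-shift h N) ↔-refl)
  (↔-trans +↔⊎ (↔-trans (↔-refl ⊎-↔ Fin-∑<↔ (λ k → h (suc k)) N) (Below-suc↔ (λ k → Fin (h k)))))

Fin-select↔ : ∀ {P : Set} → (∀ (x y : P) → x ≡ y) → (P? : Dec P) (x : ℕ) → Fin (select P? x) ↔ (P × Fin x)
Fin-select↔ P-irrelevant (yes p) x = mk↔ₛ′ (p ,_) proj₂ (λ { (p′ , i) → cong (_, i) (P-irrelevant p p′) }) (λ _ → refl)
Fin-select↔ _ (no ¬p) x = mk↔ₛ′ (λ ()) (λ { (p , _) → contradiction p ¬p }) (λ { (p , _) → contradiction p ¬p }) (λ ())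

rotate : ∀ {k} → Fin (suc k) → Fin (suc k)
rotate {k} j = suc (toℕ j) mod suc k

toℕ-iter-rotate : ∀ {k} n (j : Fin (suc k)) → toℕ (iter rotate n j) ≡ (toℕ j + n) % suc k
toℕ-iter-rotate {k} zero j = sym (trans (cong (_% suc k) (+-identityʳ (toℕ j))) (m<n⇒m%n≡m (toℕ<n j)))
toℕ-iter-rotate {k} (suc n) j = begin
  toℕ (rotate (iter rotate n j))                ≡⟨ toℕ-fromℕ< (m%n<n (suc (toℕ (iter rotate n j))) (suc k)) ⟩
  suc (toℕ (iter rotate n j)) % suc k           ≡⟨ cong (λ t → suc t % suc k) (toℕ-iter-rotate n j) ⟩
  (1 + (toℕ j + n) % suc k) % suc k             ≡⟨ %-distribˡ-+ 1 ((toℕ j + n) % suc k) (suc k) ⟩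
  (1 % suc k + (toℕ j + n) % suc k % suc k) % suc k ≡⟨ cong (λ t → (1 % suc k + t) % suc k) (m%n%n≡m%n (toℕ j + n) (suc k)) ⟩
  (1 % suc k + (toℕ j + n) % suc k) % suc k     ≡⟨ %-distribˡ-+ 1 (toℕ j + n) (suc k) ⟨
  suc (toℕ j + n) % suc k                       ≡⟨ cong (_% suc k) (+-suc (toℕ j) n) ⟨
  (toℕ j + suc n) % suc k                       ∎
  where open ≡-Reasoning

∣⇒iter-rotate-fixed : ∀ {k} n (j : Fin (suc k)) → suc k ∣ n → iter rotate n j ≡ j
∣⇒iter-rotate-fixed {k} n j (divides q refl) = toℕ-injective (begin
  toℕ (iter rotate (q * suc k) j)   ≡⟨ toℕ-iter-rotate (q * suc k) j ⟩
  (toℕ j + q * suc k) % suc k       ≡⟨ [m+kn]%n≡m%n (toℕ j) q (suc k) ⟩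
  toℕ j % suc k                     ≡⟨ m<n⇒m%n≡m (toℕ<n j) ⟩
  toℕ j                             ∎)
  where open ≡-Reasoning

iter-rotate-fixed⇒∣ : ∀ {k} n (j : Fin (suc k)) → iter rotate n j ≡ j → suc k ∣ n
iter-rotate-fixed⇒∣ {k} n j fixed = divides ((toℕ j + n) / suc k) (+-cancelˡ-≡ (toℕ j) n _ (begin
  toℕ j + n                                     ≡⟨ m≡m%n+[m/n]*n (toℕ j + n) (suc k) ⟩
  (toℕ j + n) % suc k + (toℕ j + n) / suc k * suc k ≡⟨ cong (_+ (toℕ j + n) / suc k * suc k) (trans (sym (toℕ-iter-rotate n j)) (cong toℕ fixed)) ⟩
  toℕ j + (toℕ j + n) / suc k * suc k           ∎))
  where open ≡-Reasoning

module Cycles (o : ℕ → ℕ) where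

  Point : Set
  Point = Σ ℕ λ k → Fin (o k) × Fin (suc k)

  step : Point → Point
  step (k , i , j) = k , i , rotate j

  iter-step : ∀ n k i j → iter step n (k , i , j) ≡ (k , i , iter rotate n j)
  iter-step zero k i j = refl
  iter-step (suc n) k i j = cong step (iter-step n k i j)

  Fix-step↔ : ∀ N .{{_ : NonZero N}} → Below N (λ k → suc k ∣ N × Fin (o k) × Fin (suc k)) ↔ Fix step N
  Fix-step↔ N = mk↔ₛ′ to from to∘from from∘to
    where
    rotated-component : ∀ {k i j j′} → _≡_ {A = Point} (k , i , j) (k , i , j′) → j ≡ j′
    rotated-component refl = refl
    fixed⇒∣ : ∀ {k i j} → iter step N (k , i , j) ≡ (k , i , j) → suc k ∣ N
    fixed⇒∣ {k} {i} {j} fixed = iter-rotate-fixed⇒∣ N j (rotated-component (trans (sym (iter-step N k i j)) fixed))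
    to : Below N (λ k → suc k ∣ N × Fin (o k) × Fin (suc k)) → Fix step N
    to (k , _ , k+1∣N , i , j) = (k , i , j) , trans (iter-step N k i j) (cong (λ j′ → k , i , j′) (∣⇒iter-rotate-fixed N j k+1∣N))
    from : Fix step N → Below N (λ k → suc k ∣ N × Fin (o k) × Fin (suc k))
    from ((k , i , j) , fixed) = k , ∣⇒≤ (fixed⇒∣ fixed) , fixed⇒∣ fixed , i , j
    to∘from : ∀ x → to (from x) ≡ x
    to∘from ((k , i , j) , fixed) = cong ((k , i , j) ,_) (uip _ fixed)
    from∘to : ∀ y → from (to y) ≡ y
    from∘to (k , k<N , k+1∣N , i , j) = cong₂ (λ lt d → k , lt , d , i , j) (≤-irrelevant _ k<N) (∣-irrelevant _ k+1∣N)

  Fin-divisorSum↔Fix : ∀ N .{{_ : NonZero N}} → Fin (∑[ d ≤ N ∣ N ] (o (pred d) * d)) ↔ Fix step N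
  Fin-divisorSum↔Fix N = ↔-trans (Fin-∑<↔ _ N)
    (↔-trans (Below-cong (λ k → ↔-trans (Fin-select↔ ∣-irrelevant (suc k ∣? N) (o k * suc k)) (↔-refl ×-↔ *↔×)))
             (Fix-step↔ N))

realizable-by-cycles : ∀ (R : ℕ → ℕ) → (∀ n → 0 < n → n ∣ R n) → Realizable (λ n → ∑[ d ≤ n ∣ n ] R d)
realizable-by-cycles R n∣R = Realizable-cong (λ n → ∑[ d ≤ n ∣ n ] (cycles (pred d) * d)) (λ n → ∑[ d ≤ n ∣ n ] R d)
  (λ n → divisorSum≤-cong (suc n) (suc n) cycles-fill) (Point , step , λ n → Fin-divisorSum↔Fix (suc n))
  where
  cycles : ℕ → ℕ
  cycles k = R (suc k) / suc k
  open Cycles cycles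
  cycles-fill : ∀ {N} d → 0 < d → d ≤ N → cycles (pred d) * d ≡ R d
  cycles-fill (suc k) _ _ = m/n*n≡m (n∣R (suc k) z<s)

superincreasing∧dold⇒realizable : ∀ a → Superincreasing a → DoldCongruent a → Realizable a
superincreasing∧dold⇒realizable a superincreasing dold =
  Realizable-cong (λ n → ∑[ d ≤ n ∣ n ] leastPeriodCount a d) a (λ n → divisorSum-leastPeriodCount a superincreasing z<s)
    (realizable-by-cycles (leastPeriodCount a) (leastPeriodCount-divisible a superincreasing dold))

realizable-constant-1 : Realizable (λ _ → 1)
realizable-constant-1 = ⊤ , (λ x → x) , λ _ →
  mk↔ₛ′ (λ _ → tt , refl) (λ _ → Fin.zero) (λ { (tt , fixed) → cong (tt ,_) (uip refl fixed) }) (λ { Fin.zero → refl ; (Fin.suc ()) })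

-- The sequence c a^(n-1)

c*a^pred : ℕ → ℕ → ℕ → ℕ
c*a^pred c a n = c * a ^ pred n

module _ (c a : ℕ) where

  superincreasing-c*a^pred : 1 < a → Superincreasing (c*a^pred c a)
  superincreasing-c*a^pred 1<a n = begin
    ∑[ i < n ] (c * a ^ i)  ≡⟨ *-distribˡ-∑< c (a ^_) n ⟨
    c * ∑[ i < n ] (a ^ i)  ≤⟨ *-monoʳ-≤ c (<⇒≤ (∑<-^<^ 1<a n)) ⟩
    c * a ^ n               ∎
    where open ≤-Reasoning

  dold-c*a^pred : 0 < a → (∀ {p} → Prime p → p ∣ a → p ∣ c) → DoldCongruent (c*a^pred c a)
  dold-c*a^pred 0<a p∣a⇒p∣c {p} {n@(suc s)} pr _ k p^k∣n with p ∣? a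
  ... | no p∤a = mod⁺-cancelˡ pr p∤a (suc k)
    (subst₂ (λ x y → x ≡ y [mod⁺ p ^ suc k ]) (c*a^m≡a*c*a^pred[m] 0<n*p) (c*a^m≡a*c*a^pred[m] {n} z<s)
            (mod⁺-*ˡ c (^-doldCongruent a pr z<s k p^k∣n)))
    where
    c*a^m≡a*c*a^pred[m] : ∀ {m} → 0 < m → c * a ^ m ≡ a * c*a^pred c a m
    c*a^m≡a*c*a^pred[m] {suc m} _ = x*[y*z]≡y*[x*z] c a (a ^ m)
      where
      x*[y*z]≡y*[x*z] : ∀ x y z → x * (y * z) ≡ y * (x * z)
      x*[y*z]≡y*[x*z] = solve-∀
    0<n*p : 0 < n * p
    0<n*p = <-≤-trans (<-trans z<s (prime>1 pr)) (m≤m+n p (s * p))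
  ... | yes p∣a = mod⁺-weaken p^[1+k]∣c*a^s
    (subst (_≡ c * a ^ s [mod⁺ c * a ^ s ]) (sym split) (m*n≡m[mod⁺m] (c * a ^ s) (m^n>0 a e)))
    where
    instance
      _ = prime⇒nonZero pr
      _ = >-nonZero 0<a
    e = n * p ∸ n
    split : c * a ^ pred (n * p) ≡ c * a ^ s * a ^ e
    split = begin
      c * a ^ pred (n * p)  ≡⟨ cong (λ t → c * a ^ pred t) (m+[n∸m]≡n (m≤m*n n p)) ⟨
      c * a ^ (s + e)       ≡⟨ cong (c *_) (^-distribˡ-+-* a s e) ⟩
      c * (a ^ s * a ^ e)   ≡⟨ *-assoc c (a ^ s) (a ^ e) ⟨
      c * a ^ s * a ^ e     ∎
      where open ≡-Reasoning
    p^[1+k]∣c*a^s : p ^ suc k ∣ c * a ^ s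
    p^[1+k]∣c*a^s = ∣-trans (^-monoʳ-∣ p {suc k} (<-≤-trans (n<m^n (prime>1 pr) k) (∣⇒≤ p^k∣n)))
                            (*-pres-∣ (p∣a⇒p∣c pr p∣a) (^-monoˡ-∣ s p∣a))

mainTheorem6 : (a b : ℕ) → 0 < a → .{{_ : NonZero b}} → b ∣ a →
    ((p : ℕ) → Prime p → p ∣ a → p ∣ (a / b)) →
    Realizable (λ n → (a ^ n) / b)
mainTheorem6 a b 0<a b∣a p∣a⇒p∣a/b with m≤n⇒m<n∨m≡n 0<a
mainTheorem6 1 b _ b∣1 _ | inj₂ refl with ∣1⇒≡1 b∣1
... | refl = Realizable-cong (λ _ → 1) (λ n → 1 ^ n / 1) 1≡1^[1+n]/1 realizable-constant-1
  where
  1≡1^[1+n]/1 : ∀ n → 1 ≡ 1 ^ suc n / 1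
  1≡1^[1+n]/1 n = sym (trans (n/1≡n (1 ^ suc n)) (^-zeroˡ (suc n)))
mainTheorem6 a b 0<a (divides c a≡c*b) p∣a⇒p∣a/b | inj₁ 1<a =
  Realizable-cong (c*a^pred c a) (λ n → a ^ n / b) c*a^n≡a^[1+n]/b
    (superincreasing∧dold⇒realizable (c*a^pred c a) (superincreasing-c*a^pred c a 1<a) (dold-c*a^pred c a 0<a p∣a⇒p∣c))
  where
  p∣a⇒p∣c : ∀ {p} → Prime p → p ∣ a → p ∣ c
  p∣a⇒p∣c {p} pr p∣a = subst (p ∣_) (trans (cong (_/ b) a≡c*b) (m*n/n≡m c b)) (p∣a⇒p∣a/b p pr p∣a)
  x*y*z≡x*z*y : ∀ x y z → x * y * z ≡ x * z * y
  x*y*z≡x*z*y = solve-∀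
  c*a^n≡a^[1+n]/b : ∀ n → c * a ^ n ≡ a ^ suc n / b
  c*a^n≡a^[1+n]/b n = sym (begin
    a * a ^ n / b      ≡⟨ cong (λ x → x * a ^ n / b) a≡c*b ⟩
    c * b * a ^ n / b  ≡⟨ cong (_/ b) (x*y*z≡x*z*y c b (a ^ n)) ⟩
    c * a ^ n * b / b  ≡⟨ m*n/n≡m (c * a ^ n) b ⟩
    c * a ^ n          ∎)
    where open ≡-Reasoning
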